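{- Let $U:\mathcal{E}\to\mathcal{B}$ be a fibration with a full and faithful functor $E:\mathcal{B}\to\mathcal{E}$ such that $UE=Id_{\mathcal{B}}$ and $E$ has a left adjoint $Q$ with unit $\eta$ (a QCE). Let $F:\mathcal{B}\to\mathcal{B}$ be a functor, and define $\rho:\mathcal{E}\to\mathcal{B}^{\to}$ by $\rho P=U\eta_P$, $J:\mathcal{B}^{\to}\to\mathcal{E}$ by $J(f:X\to Y)=f^*EY$, and $\check F=J\,F^{\to}\,\rho:\mathcal{E}\to\mathcal{E}$. Then $U\check F=FU$ and $\check F E\cong EF$.
   Context: $U$ is a fibration: for every object $P$ of $\mathcal{E}$ and $f:X\to UP$ there is a cartesian morphism above $f$ with codomain $P$, whose domain is $f^*P$; this extends to reindexing functors $f^*:\mathcal{E}_Y\to\mathcal{E}_X$ between fibres (and $J$ extends to morphisms of the arrow category via the universal property of cartesian morphisms). $\mathcal{B}^{\to}$ is the arrow category of $\mathcal{B}$ (objects morphisms of $\mathcal{B}$, morphisms commuting squares), $\rho$ acts on morphisms via $U$ and $UQ$, and $F^{\to}:\mathcal{B}^{\to}\to\mathcal{B}^{\to}$ applies $F$ to arrows and squares. -}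

module Defs where

open import Level using (Level; _⊔_) renaming (suc to lsuc)
open import Relation.Binary using (Rel; IsEquivalence; Setoid)
open import Relation.Binary.PropositionalEquality
  using (_≡_; refl; sym; trans; subst₂; cong)
open import Data.Product using (Σ; Σ-syntax; _×_; _,_; proj₁; proj₂)
import Relation.Binary.Reasoning.Setoid as SetoidR

record Category (o ℓ e : Level) : Set (lsuc (o ⊔ ℓ ⊔ e)) where
  infixr 9 _∘_
  infix  4 _≈_
  field
    Obj       : Set o
    _⇒_       : Obj → Obj → Set ℓ
    _≈_       : ∀ {A B} → Rel (A ⇒ B) e
    id        : ∀ {A} → A ⇒ A
    _∘_       : ∀ {A B C} → B ⇒ C → A ⇒ B → A ⇒ C
    assoc     : ∀ {A B C D} {f : A ⇒ B} {g : B ⇒ C} {h : C ⇒ D} →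
                (h ∘ g) ∘ f ≈ h ∘ (g ∘ f)
    identityˡ : ∀ {A B} {f : A ⇒ B} → id ∘ f ≈ f
    identityʳ : ∀ {A B} {f : A ⇒ B} → f ∘ id ≈ f
    equiv     : ∀ {A B} → IsEquivalence (_≈_ {A} {B})
    ∘-resp-≈  : ∀ {A B C} {f h : B ⇒ C} {g i : A ⇒ B} →
                f ≈ h → g ≈ i → f ∘ g ≈ h ∘ i

  hom-setoid : Obj → Obj → Setoid ℓ e
  hom-setoid A B = record { Carrier = A ⇒ B ; _≈_ = _≈_ ; isEquivalence = equiv }

  module Equiv {A B : Obj} = IsEquivalence (equiv {A} {B})

  tr : ∀ {A A' B B'} → A ≡ A' → B ≡ B' → A ⇒ B → A' ⇒ B'
  tr p q f = subst₂ _⇒_ p q f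

  tr-∘ : ∀ {A A' B B' C C'} (p : A ≡ A') (q : B ≡ B') (r : C ≡ C')
         (g : B ⇒ C) (f : A ⇒ B) → tr q r g ∘ tr p q f ≡ tr p r (g ∘ f)
  tr-∘ refl refl refl g f = refl

  tr-resp : ∀ {A A' B B'} (p : A ≡ A') (q : B ≡ B') {f g : A ⇒ B} →
            f ≈ g → tr p q f ≈ tr p q g
  tr-resp refl refl x = x

  tr-flip : ∀ {A A' B B'} (p : A ≡ A') (q : B ≡ B') {f : A ⇒ B} {g : A' ⇒ B'} →
            tr p q f ≈ g → f ≈ tr (sym p) (sym q) g
  tr-flip refl refl x = x

  tr-tr : ∀ {A A' B B'} (p : A ≡ A') (q : B ≡ B') (f : A ⇒ B) →
          tr p refl (tr refl q f) ≡ tr p q f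
  tr-tr refl refl f = refl

  ≡⇒≈ : ∀ {A B} {f g : A ⇒ B} → f ≡ g → f ≈ g
  ≡⇒≈ refl = Equiv.refl

open Category

infix 4 _[_≈_]
_[_≈_] : ∀ {o ℓ e} (C : Category o ℓ e) {A B : Obj C} → (C ⇒ A) B → (C ⇒ A) B → Set e
C [ f ≈ g ] = Category._≈_ C f g

module _ {o ℓ e o' ℓ' e'} (C : Category o ℓ e) (D : Category o' ℓ' e') where
  private
    module C = Category C
    module D = Category D

  record RawFunctor : Set (o ⊔ ℓ ⊔ o' ⊔ ℓ') where
    field
      F₀ : C.Obj → D.Obj
      F₁ : ∀ {A B} → A C.⇒ B → F₀ A D.⇒ F₀ B

  record Functor : Set (o ⊔ ℓ ⊔ e ⊔ o' ⊔ ℓ' ⊔ e') where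
    field
      F₀ : C.Obj → D.Obj
      F₁ : ∀ {A B} → A C.⇒ B → F₀ A D.⇒ F₀ B
      identity     : ∀ {A} → F₁ (C.id {A}) D.≈ D.id
      homomorphism : ∀ {A B X} {f : A C.⇒ B} {g : B C.⇒ X} →
                     F₁ (g C.∘ f) D.≈ F₁ g D.∘ F₁ f
      F-resp-≈     : ∀ {A B} {f g : A C.⇒ B} → f C.≈ g → F₁ f D.≈ F₁ g

    raw : RawFunctor
    raw = record { F₀ = F₀ ; F₁ = F₁ }

  _≡R_ : RawFunctor → RawFunctor → Set (o ⊔ ℓ ⊔ o' ⊔ e')
  F ≡R G = Σ[ eq ∈ (∀ X → RawFunctor.F₀ F X ≡ RawFunctor.F₀ G X) ]
             (∀ {A B} (f : A C.⇒ B) →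
               D.tr (eq A) (eq B) (RawFunctor.F₁ F f) D.≈ RawFunctor.F₁ G f)

  _≡F_ : Functor → Functor → Set (o ⊔ ℓ ⊔ o' ⊔ e')
  F ≡F G = Functor.raw F ≡R Functor.raw G

  record RawNatIso (F G : RawFunctor) : Set (o ⊔ ℓ ⊔ e' ⊔ ℓ') where
    private
      module F = RawFunctor F
      module G = RawFunctor G
    field
      η       : ∀ X → F.F₀ X D.⇒ G.F₀ X
      η⁻¹     : ∀ X → G.F₀ X D.⇒ F.F₀ X
      isoˡ    : ∀ X → η⁻¹ X D.∘ η X D.≈ D.id
      isoʳ    : ∀ X → η X D.∘ η⁻¹ X D.≈ D.id
      commute : ∀ {A B} (f : A C.⇒ B) → G.F₁ f D.∘ η A D.≈ η B D.∘ F.F₁ f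

  module _ (F G : Functor) where
    private
      module F = Functor F
      module G = Functor G
    record NaturalTransformation : Set (o ⊔ ℓ ⊔ e' ⊔ ℓ') where
      field
        η       : ∀ X → F.F₀ X D.⇒ G.F₀ X
        commute : ∀ {A B} (f : A C.⇒ B) → G.F₁ f D.∘ η A D.≈ η B D.∘ F.F₁ f

  Full : Functor → Set (o ⊔ ℓ ⊔ ℓ' ⊔ e')
  Full F = ∀ {A B} (g : Functor.F₀ F A D.⇒ Functor.F₀ F B) →
             Σ[ f ∈ A C.⇒ B ] Functor.F₁ F f D.≈ g

  Faithful : Functor → Set (o ⊔ ℓ ⊔ e ⊔ e')
  Faithful F = ∀ {A B} (f g : A C.⇒ B) →
                 Functor.F₁ F f D.≈ Functor.F₁ F g → f C.≈ g

idF : ∀ {o ℓ e} {C : Category o ℓ e} → Functor C C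
idF {C = C} = record
  { F₀ = λ X → X ; F₁ = λ f → f
  ; identity = Equiv.refl C ; homomorphism = Equiv.refl C ; F-resp-≈ = λ x → x }

infixr 9 _∘F_ _∘R_
_∘F_ : ∀ {o ℓ e o' ℓ' e' o'' ℓ'' e''} {C : Category o ℓ e} {D : Category o' ℓ' e'}
       {X : Category o'' ℓ'' e''} → Functor D X → Functor C D → Functor C X
_∘F_ {X = X} G F = record
  { F₀ = λ A → G.F₀ (F.F₀ A)
  ; F₁ = λ f → G.F₁ (F.F₁ f)
  ; identity = Equiv.trans X (G.F-resp-≈ F.identity) G.identity
  ; homomorphism = Equiv.trans X (G.F-resp-≈ F.homomorphism) G.homomorphism
  ; F-resp-≈ = λ x → G.F-resp-≈ (F.F-resp-≈ x) }
  where module G = Functor G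
        module F = Functor F

_∘R_ : ∀ {o ℓ e o' ℓ' e' o'' ℓ'' e''} {C : Category o ℓ e} {D : Category o' ℓ' e'}
       {X : Category o'' ℓ'' e''} → RawFunctor D X → RawFunctor C D → RawFunctor C X
G ∘R F = record { F₀ = λ A → G.F₀ (F.F₀ A) ; F₁ = λ f → G.F₁ (F.F₁ f) }
  where module G = RawFunctor G
        module F = RawFunctor F

record Adjunction {o ℓ e o' ℓ' e'} {C : Category o ℓ e} {D : Category o' ℓ' e'}
       (L : Functor C D) (R : Functor D C) : Set (o ⊔ ℓ ⊔ e ⊔ o' ⊔ ℓ' ⊔ e') where
  private
    module C = Category C
    module D = Category D
    module L = Functor L
    module R = Functor R
  field
    unit   : NaturalTransformation C C idF (R ∘F L)
    counit : NaturalTransformation D D (L ∘F R) idF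
  module unit = NaturalTransformation unit
  module counit = NaturalTransformation counit
  field
    zig : ∀ {A} → counit.η (L.F₀ A) D.∘ L.F₁ (unit.η A) D.≈ D.id
    zag : ∀ {B} → R.F₁ (counit.η B) C.∘ unit.η (R.F₀ B) C.≈ C.id

module _ {o ℓ e o' ℓ' e'} {𝓔 : Category o ℓ e} {𝓑 : Category o' ℓ' e'}
         (U : Functor 𝓔 𝓑) where
  private
    module 𝓔 = Category 𝓔
    module 𝓑 = Category 𝓑
    module U = Functor U

  Cartesian : ∀ {P' P} → P' 𝓔.⇒ P → Set (o ⊔ ℓ ⊔ e ⊔ ℓ' ⊔ e')
  Cartesian {P'} {P} φ =
    ∀ {R} (ψ : R 𝓔.⇒ P) (h : U.F₀ R 𝓑.⇒ U.F₀ P') →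
      U.F₁ ψ 𝓑.≈ U.F₁ φ 𝓑.∘ h →
      Σ[ θ ∈ R 𝓔.⇒ P' ]
        ((φ 𝓔.∘ θ 𝓔.≈ ψ × U.F₁ θ 𝓑.≈ h) ×
         (∀ (θ' : R 𝓔.⇒ P') → φ 𝓔.∘ θ' 𝓔.≈ ψ → U.F₁ θ' 𝓑.≈ h → θ' 𝓔.≈ θ))

  record Fibration : Set (o ⊔ ℓ ⊔ e ⊔ o' ⊔ ℓ' ⊔ e') where
    field
      lift-obj  : ∀ (P : 𝓔.Obj) {X} (f : X 𝓑.⇒ U.F₀ P) → 𝓔.Obj
      lift-fib  : ∀ (P : 𝓔.Obj) {X} (f : X 𝓑.⇒ U.F₀ P) → U.F₀ (lift-obj P f) ≡ X
      lift      : ∀ (P : 𝓔.Obj) {X} (f : X 𝓑.⇒ U.F₀ P) → lift-obj P f 𝓔.⇒ P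
      lift-over : ∀ (P : 𝓔.Obj) {X} (f : X 𝓑.⇒ U.F₀ P) →
                  𝓑.tr (lift-fib P f) refl (U.F₁ (lift P f)) 𝓑.≈ f
      lift-cart : ∀ (P : 𝓔.Obj) {X} (f : X 𝓑.⇒ U.F₀ P) → Cartesian (lift P f)

module _ {o ℓ e} (B : Category o ℓ e) where
  private module B = Category B

  record ArrObj : Set (o ⊔ ℓ) where
    constructor arrow
    field
      dom cod : B.Obj
      arr     : dom B.⇒ cod

  record ArrHom (f g : ArrObj) : Set (ℓ ⊔ e) where
    constructor square
    private
      module f = ArrObj f
      module g = ArrObj g
    field
      top  : f.dom B.⇒ g.dom
      bot  : f.cod B.⇒ g.cod
      comm : bot B.∘ f.arr B.≈ g.arr B.∘ top

module QCE {o ℓ e o' ℓ' e'} {𝓔 : Category o ℓ e} {𝓑 : Category o' ℓ' e'}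
           (U : Functor 𝓔 𝓑) (fib : Fibration U)
           (E : Functor 𝓑 𝓔) (UE : _≡F_ 𝓑 𝓑 (U ∘F E) idF)
           (Q : Functor 𝓔 𝓑) (adj : Adjunction Q E)
           (F : Functor 𝓑 𝓑) where
  private
    module 𝓔 = Category 𝓔
    module 𝓑 = Category 𝓑
    module U = Functor U
    module E = Functor E
    module Q = Functor Q
    module F = Functor F
    module fib = Fibration fib
    module adj = Adjunction adj

  u : ∀ X → U.F₀ (E.F₀ X) ≡ X
  u = proj₁ UE

  UE₁ : ∀ {A B} (f : A 𝓑.⇒ B) → U.F₁ (E.F₁ f) 𝓑.≈ 𝓑.tr (sym (u A)) (sym (u B)) f
  UE₁ {A} {B} f = 𝓑.tr-flip (u A) (u B) (proj₂ UE f)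

  ρ₀ : 𝓔.Obj → ArrObj 𝓑
  ρ₀ P = arrow (U.F₀ P) (Q.F₀ P) (𝓑.tr refl (u (Q.F₀ P)) (U.F₁ (adj.unit.η P)))

  ρ₁ : ∀ {P P'} → P 𝓔.⇒ P' → ArrHom 𝓑 (ρ₀ P) (ρ₀ P')
  ρ₁ {P} {P'} h = square (U.F₁ h) (Q.F₁ h) pf
    where
      open SetoidR (𝓑.hom-setoid (U.F₀ P) (Q.F₀ P'))
      uQ  = u (Q.F₀ P)
      uQ' = u (Q.F₀ P')
      ηP  = adj.unit.η P
      ηP' = adj.unit.η P'
      pf : Q.F₁ h 𝓑.∘ 𝓑.tr refl uQ (U.F₁ ηP) 𝓑.≈ 𝓑.tr refl uQ' (U.F₁ ηP') 𝓑.∘ U.F₁ h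
      pf = begin
        Q.F₁ h 𝓑.∘ 𝓑.tr refl uQ (U.F₁ ηP)
          ≈⟨ 𝓑.∘-resp-≈ (𝓑.Equiv.sym (proj₂ UE (Q.F₁ h))) 𝓑.Equiv.refl ⟩
        𝓑.tr uQ uQ' (U.F₁ (E.F₁ (Q.F₁ h))) 𝓑.∘ 𝓑.tr refl uQ (U.F₁ ηP)
          ≡⟨ 𝓑.tr-∘ refl uQ uQ' _ _ ⟩
        𝓑.tr refl uQ' (U.F₁ (E.F₁ (Q.F₁ h)) 𝓑.∘ U.F₁ ηP)
          ≈⟨ 𝓑.tr-resp refl uQ' (𝓑.Equiv.sym U.homomorphism) ⟩
        𝓑.tr refl uQ' (U.F₁ (E.F₁ (Q.F₁ h) 𝓔.∘ ηP))
          ≈⟨ 𝓑.tr-resp refl uQ' (U.F-resp-≈ (adj.unit.commute h)) ⟩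
        𝓑.tr refl uQ' (U.F₁ (ηP' 𝓔.∘ h))
          ≈⟨ 𝓑.tr-resp refl uQ' U.homomorphism ⟩
        𝓑.tr refl uQ' (U.F₁ ηP' 𝓑.∘ U.F₁ h)
          ≡⟨ sym (𝓑.tr-∘ refl refl uQ' _ _) ⟩
        𝓑.tr refl uQ' (U.F₁ ηP') 𝓑.∘ U.F₁ h ∎

  F→₀ : ArrObj 𝓑 → ArrObj 𝓑
  F→₀ (arrow X Y f) = arrow (F.F₀ X) (F.F₀ Y) (F.F₁ f)

  F→₁ : ∀ {f g} → ArrHom 𝓑 f g → ArrHom 𝓑 (F→₀ f) (F→₀ g)
  F→₁ (square a b c) = square (F.F₁ a) (F.F₁ b)
    (𝓑.Equiv.trans (𝓑.Equiv.sym F.homomorphism)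
      (𝓑.Equiv.trans (F.F-resp-≈ c) F.homomorphism))

  J-base : (f : ArrObj 𝓑) → ArrObj.dom f 𝓑.⇒ U.F₀ (E.F₀ (ArrObj.cod f))
  J-base (arrow X Y f) = 𝓑.tr refl (sym (u Y)) f

  J₀ : ArrObj 𝓑 → 𝓔.Obj
  J₀ f = fib.lift-obj (E.F₀ (ArrObj.cod f)) (J-base f)

  private
    lift-over' : ∀ {X Y} (f : X 𝓑.⇒ Y) →
      U.F₁ (fib.lift (E.F₀ Y) (J-base (arrow X Y f)))
        𝓑.≈ 𝓑.tr (sym (fib.lift-fib (E.F₀ Y) (J-base (arrow X Y f)))) (sym (u Y)) f
    lift-over' {X} {Y} f =
      𝓑.Equiv.trans (𝓑.tr-flip _ refl (fib.lift-over (E.F₀ Y) (J-base (arrow X Y f))))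
                    (𝓑.≡⇒≈ (𝓑.tr-tr _ (sym (u Y)) f))

  J₁ : ∀ {f g} → ArrHom 𝓑 f g → J₀ f 𝓔.⇒ J₀ g
  J₁ {arrow X Y f} {arrow X' Y' g} (square a b c) =
    proj₁ (fib.lift-cart (E.F₀ Y') (J-base (arrow X' Y' g)) ψ h pf)
    where
      φf = fib.lift (E.F₀ Y) (J-base (arrow X Y f))
      φg = fib.lift (E.F₀ Y') (J-base (arrow X' Y' g))
      pF = fib.lift-fib (E.F₀ Y) (J-base (arrow X Y f))
      pG = fib.lift-fib (E.F₀ Y') (J-base (arrow X' Y' g))
      ψ = E.F₁ b 𝓔.∘ φf
      h = 𝓑.tr (sym pF) (sym pG) a
      open SetoidR (𝓑.hom-setoid (U.F₀ (J₀ (arrow X Y f))) (U.F₀ (E.F₀ Y')))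
      pf : U.F₁ ψ 𝓑.≈ U.F₁ φg 𝓑.∘ h
      pf = begin
        U.F₁ (E.F₁ b 𝓔.∘ φf)                       ≈⟨ U.homomorphism ⟩
        U.F₁ (E.F₁ b) 𝓑.∘ U.F₁ φf                   ≈⟨ 𝓑.∘-resp-≈ (UE₁ b) (lift-over' f) ⟩
        𝓑.tr (sym (u Y)) (sym (u Y')) b 𝓑.∘ 𝓑.tr (sym pF) (sym (u Y)) f
                                                    ≡⟨ 𝓑.tr-∘ _ _ _ b f ⟩
        𝓑.tr (sym pF) (sym (u Y')) (b 𝓑.∘ f)        ≈⟨ 𝓑.tr-resp _ _ c ⟩
        𝓑.tr (sym pF) (sym (u Y')) (g 𝓑.∘ a)        ≡⟨ sym (𝓑.tr-∘ _ _ _ g a) ⟩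
        𝓑.tr (sym pG) (sym (u Y')) g 𝓑.∘ h          ≈⟨ 𝓑.∘-resp-≈ (𝓑.Equiv.sym (lift-over' g)) 𝓑.Equiv.refl ⟩
        U.F₁ φg 𝓑.∘ h ∎

  F̌ : RawFunctor 𝓔 𝓔
  F̌ = record { F₀ = λ P → J₀ (F→₀ (ρ₀ P)) ; F₁ = λ h → J₁ (F→₁ (ρ₁ h)) }

-- U F̌ = F U holds because J lands in the fibre over the domain and J₁ lies over the top
-- edge of a square.  For F̌ E ≅ E F: since E is fully faithful the unit at E X is
-- invertible, hence so is F(ρ(E X)); a cartesian morphism over an isomorphism is itself
-- an isomorphism, so the cartesian lift J(F ρ(E X)) → E F Q E X followed by E F of the
-- (invertible) counit is the required natural isomorphism.
module Submission where

open import Level using (_⊔_)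
open import Data.Product using (_×_; _,_; proj₁; proj₂)
open import Relation.Binary.PropositionalEquality using (_≡_; refl; sym)
import Relation.Binary.Reasoning.Setoid as SetoidR

open import Defs

module _ {o ℓ e} (C : Category o ℓ e) where
  open Category C

  tr-tr-sym : ∀ {A A' B B'} (p : A ≡ A') (q : B ≡ B') (f : A' ⇒ B') →
              tr p q (tr (sym p) (sym q) f) ≡ f
  tr-tr-sym refl refl f = refl

  record Iso {A B} (f : A ⇒ B) : Set (ℓ ⊔ e) where
    field
      inv      : B ⇒ A
      inverseˡ : inv ∘ f ≈ id
      inverseʳ : f ∘ inv ≈ id

  Iso-inv : ∀ {A B} {f : A ⇒ B} (i : Iso f) → Iso (Iso.inv i)
  Iso-inv {f = f} i = record
    { inv = f ; inverseˡ = Iso.inverseʳ i ; inverseʳ = Iso.inverseˡ i }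

  Iso-resp-≈ : ∀ {A B} {f g : A ⇒ B} → f ≈ g → Iso f → Iso g
  Iso-resp-≈ f≈g i = record
    { inv      = inv
    ; inverseˡ = Equiv.trans (∘-resp-≈ Equiv.refl (Equiv.sym f≈g)) inverseˡ
    ; inverseʳ = Equiv.trans (∘-resp-≈ (Equiv.sym f≈g) Equiv.refl) inverseʳ
    }
    where open Iso i

  Iso-tr : ∀ {A A' B B'} (p : A ≡ A') (q : B ≡ B') {f : A ⇒ B} → Iso f → Iso (tr p q f)
  Iso-tr refl refl i = i

  cancelInner : ∀ {A B B' C} {h : B ⇒ C} {k : B' ⇒ B} {k' : B ⇒ B'} {h' : A ⇒ B} →
                k ∘ k' ≈ id → (h ∘ k) ∘ (k' ∘ h') ≈ h ∘ h'
  cancelInner {h = h} {k} {k'} {h'} kk' = begin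
    (h ∘ k) ∘ (k' ∘ h')  ≈⟨ assoc ⟩
    h ∘ (k ∘ (k' ∘ h'))  ≈⟨ ∘-resp-≈ Equiv.refl (Equiv.sym assoc) ⟩
    h ∘ ((k ∘ k') ∘ h')  ≈⟨ ∘-resp-≈ Equiv.refl (∘-resp-≈ kk' Equiv.refl) ⟩
    h ∘ (id ∘ h')        ≈⟨ ∘-resp-≈ Equiv.refl identityˡ ⟩
    h ∘ h'               ∎
    where open SetoidR (hom-setoid _ _)

  Iso-∘ : ∀ {A B C} {g : B ⇒ C} {f : A ⇒ B} → Iso g → Iso f → Iso (g ∘ f)
  Iso-∘ ig if = record
    { inv      = Iso.inv if ∘ Iso.inv ig
    ; inverseˡ = Equiv.trans (cancelInner (Iso.inverseˡ ig)) (Iso.inverseˡ if)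
    ; inverseʳ = Equiv.trans (cancelInner (Iso.inverseʳ if)) (Iso.inverseʳ ig)
    }

module _ {o ℓ e o' ℓ' e'} {C : Category o ℓ e} {D : Category o' ℓ' e'}
         (F : Functor C D) where
  private
    module C = Category C
    module D = Category D
  open Functor F

  F-resp-Iso : ∀ {A B} {f : A C.⇒ B} → Iso C f → Iso D (F₁ f)
  F-resp-Iso i = record
    { inv      = F₁ inv
    ; inverseˡ = D.Equiv.trans (D.Equiv.sym homomorphism)
                   (D.Equiv.trans (F-resp-≈ inverseˡ) identity)
    ; inverseʳ = D.Equiv.trans (D.Equiv.sym homomorphism)
                   (D.Equiv.trans (F-resp-≈ inverseʳ) identity)
    }
    where open Iso i

module _ {o ℓ e o' ℓ' e'} {C : Category o ℓ e} {D : Category o' ℓ' e'}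
         {L : Functor C D} {R : Functor D C} (adj : Adjunction L R) where
  private
    module C = Category C
    module D = Category D
    module L = Functor L
    module R = Functor R
  open Adjunction adj

  counit-adjunct : ∀ {A Z} (g : L.F₀ A D.⇒ Z) →
                   counit.η Z D.∘ L.F₁ (R.F₁ g C.∘ unit.η A) D.≈ g
  counit-adjunct {A} {Z} g = begin
    counit.η Z D.∘ L.F₁ (R.F₁ g C.∘ unit.η A)
      ≈⟨ D.∘-resp-≈ D.Equiv.refl L.homomorphism ⟩
    counit.η Z D.∘ (L.F₁ (R.F₁ g) D.∘ L.F₁ (unit.η A))
      ≈⟨ D.Equiv.sym D.assoc ⟩
    (counit.η Z D.∘ L.F₁ (R.F₁ g)) D.∘ L.F₁ (unit.η A)
      ≈⟨ D.∘-resp-≈ (D.Equiv.sym (counit.commute g)) D.Equiv.refl ⟩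
    (g D.∘ counit.η (L.F₀ A)) D.∘ L.F₁ (unit.η A)
      ≈⟨ D.assoc ⟩
    g D.∘ (counit.η (L.F₀ A) D.∘ L.F₁ (unit.η A))
      ≈⟨ D.∘-resp-≈ D.Equiv.refl zig ⟩
    g D.∘ D.id
      ≈⟨ D.identityʳ ⟩
    g ∎
    where open SetoidR (D.hom-setoid _ _)

  adjunct-injective : ∀ {A Z} {g h : L.F₀ A D.⇒ Z} →
                      R.F₁ g C.∘ unit.η A C.≈ R.F₁ h C.∘ unit.η A → g D.≈ h
  adjunct-injective eq =
    D.Equiv.trans (D.Equiv.sym (counit-adjunct _))
      (D.Equiv.trans (D.∘-resp-≈ D.Equiv.refl (L.F-resp-≈ eq)) (counit-adjunct _))

  -- The inverse of ε_X is the preimage under R of η_{RX}.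
  counit-Iso : Full D C R → Faithful D C R → ∀ X → Iso D (counit.η X)
  counit-Iso full faithful X = record
    { inv      = j
    ; inverseˡ = adjunct-injective jε-adjunct
    ; inverseʳ = faithful _ _ εj-image
    }
    where
      j   = proj₁ (full (unit.η (R.F₀ X)))
      Rj  = proj₂ (full (unit.η (R.F₀ X)))
      εj-image : R.F₁ (counit.η X D.∘ j) C.≈ R.F₁ D.id
      εj-image = begin
        R.F₁ (counit.η X D.∘ j)                 ≈⟨ R.homomorphism ⟩
        R.F₁ (counit.η X) C.∘ R.F₁ j            ≈⟨ C.∘-resp-≈ C.Equiv.refl Rj ⟩
        R.F₁ (counit.η X) C.∘ unit.η (R.F₀ X)   ≈⟨ zag ⟩
        C.id                                    ≈⟨ C.Equiv.sym R.identity ⟩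
        R.F₁ D.id                               ∎
        where open SetoidR (C.hom-setoid _ _)
      jε-adjunct : R.F₁ (j D.∘ counit.η X) C.∘ unit.η (R.F₀ X)
                   C.≈ R.F₁ D.id C.∘ unit.η (R.F₀ X)
      jε-adjunct = begin
        R.F₁ (j D.∘ counit.η X) C.∘ unit.η (R.F₀ X)
          ≈⟨ C.∘-resp-≈ R.homomorphism C.Equiv.refl ⟩
        (R.F₁ j C.∘ R.F₁ (counit.η X)) C.∘ unit.η (R.F₀ X)
          ≈⟨ C.assoc ⟩
        R.F₁ j C.∘ (R.F₁ (counit.η X) C.∘ unit.η (R.F₀ X))
          ≈⟨ C.∘-resp-≈ Rj zag ⟩
        unit.η (R.F₀ X) C.∘ C.id
          ≈⟨ C.identityʳ ⟩
        unit.η (R.F₀ X)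
          ≈⟨ C.Equiv.sym (C.Equiv.trans (C.∘-resp-≈ R.identity C.Equiv.refl) C.identityˡ) ⟩
        R.F₁ D.id C.∘ unit.η (R.F₀ X) ∎
        where open SetoidR (C.hom-setoid _ _)

  unit-Iso : Full D C R → Faithful D C R → ∀ X → Iso C (unit.η (R.F₀ X))
  unit-Iso full faithful X =
    Iso-resp-≈ C (proj₂ (full (unit.η (R.F₀ X))))
      (F-resp-Iso R (Iso-inv D (counit-Iso full faithful X)))

module _ {o ℓ e o' ℓ' e'} {𝓔 : Category o ℓ e} {𝓑 : Category o' ℓ' e'}
         (U : Functor 𝓔 𝓑) where
  private
    module 𝓔 = Category 𝓔
    module 𝓑 = Category 𝓑
    module U = Functor U

  Cartesian-Iso : ∀ {P' P} {φ : P' 𝓔.⇒ P} → Cartesian U φ → Iso 𝓑 (U.F₁ φ) → Iso 𝓔 φ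
  Cartesian-Iso {φ = φ} cart iφ = record
    { inv      = ψ
    ; inverseˡ = 𝓔.Equiv.trans (unique (ψ 𝓔.∘ φ) φψφ≈φ Uψφ≈id)
                   (𝓔.Equiv.sym (unique 𝓔.id 𝓔.identityʳ U.identity))
    ; inverseʳ = φψ≈id
    }
    where
      open Iso iφ
      section = cart 𝓔.id inv (𝓑.Equiv.trans U.identity (𝓑.Equiv.sym inverseʳ))
      ψ       = proj₁ section
      φψ≈id   = proj₁ (proj₁ (proj₂ section))
      Uψ≈inv  = proj₂ (proj₁ (proj₂ section))
      unique  = proj₂ (proj₂ (cart φ 𝓑.id (𝓑.Equiv.sym 𝓑.identityʳ)))
      φψφ≈φ : φ 𝓔.∘ (ψ 𝓔.∘ φ) 𝓔.≈ φ
      φψφ≈φ = 𝓔.Equiv.trans (𝓔.Equiv.sym 𝓔.assoc)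
                (𝓔.Equiv.trans (𝓔.∘-resp-≈ φψ≈id 𝓔.Equiv.refl) 𝓔.identityˡ)
      Uψφ≈id : U.F₁ (ψ 𝓔.∘ φ) 𝓑.≈ 𝓑.id
      Uψφ≈id = 𝓑.Equiv.trans U.homomorphism
                 (𝓑.Equiv.trans (𝓑.∘-resp-≈ Uψ≈inv 𝓑.Equiv.refl) inverseˡ)

module F̌-Properties {o ℓ e o' ℓ' e'} {𝓔 : Category o ℓ e} {𝓑 : Category o' ℓ' e'}
         (U : Functor 𝓔 𝓑) (fib : Fibration U)
         (E : Functor 𝓑 𝓔) (UE : _≡F_ 𝓑 𝓑 (U ∘F E) idF)
         (Q : Functor 𝓔 𝓑) (adj : Adjunction Q E)
         (F : Functor 𝓑 𝓑) where
  open QCE U fib E UE Q adj F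
  private
    module 𝓔 = Category 𝓔
    module 𝓑 = Category 𝓑
    module U = Functor U
    module E = Functor E
    module Q = Functor Q
    module F = Functor F
    module EF = Functor (E ∘F F)
    module fib = Fibration fib
    module adj = Adjunction adj

  J₀-fibre : ∀ {X Y} (f : X 𝓑.⇒ Y) → U.F₀ (J₀ (arrow X Y f)) ≡ X
  J₀-fibre {X} {Y} f = fib.lift-fib (E.F₀ Y) (J-base (arrow X Y f))

  lift-J : ∀ {X Y} (f : X 𝓑.⇒ Y) → J₀ (arrow X Y f) 𝓔.⇒ E.F₀ Y
  lift-J {X} {Y} f = fib.lift (E.F₀ Y) (J-base (arrow X Y f))

  U-lift-J : ∀ {X Y} (f : X 𝓑.⇒ Y) →
             U.F₁ (lift-J f) 𝓑.≈ 𝓑.tr (sym (J₀-fibre f)) (sym (u Y)) f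
  U-lift-J {X} {Y} f =
    𝓑.Equiv.trans (𝓑.tr-flip _ refl (fib.lift-over (E.F₀ Y) (J-base (arrow X Y f))))
                  (𝓑.≡⇒≈ (𝓑.tr-tr _ (sym (u Y)) f))

  J₁-over : ∀ {X Y X' Y'} {f : X 𝓑.⇒ Y} {g : X' 𝓑.⇒ Y'}
            (s : ArrHom 𝓑 (arrow X Y f) (arrow X' Y' g)) →
            U.F₁ (J₁ s) 𝓑.≈ 𝓑.tr (sym (J₀-fibre f)) (sym (J₀-fibre g)) (ArrHom.top s)
  J₁-over (square a b c) = proj₂ (proj₁ (proj₂ (fib.lift-cart _ _ _ _ _)))

  J₁-lift : ∀ {X Y X' Y'} {f : X 𝓑.⇒ Y} {g : X' 𝓑.⇒ Y'}
            (s : ArrHom 𝓑 (arrow X Y f) (arrow X' Y' g)) →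
            lift-J g 𝓔.∘ J₁ s 𝓔.≈ E.F₁ (ArrHom.bot s) 𝓔.∘ lift-J f
  J₁-lift (square a b c) = proj₁ (proj₁ (proj₂ (fib.lift-cart _ _ _ _ _)))

  U∘F̌≡F∘U : _≡R_ 𝓔 𝓑 (Functor.raw U ∘R F̌) (Functor.raw (F ∘F U))
  U∘F̌≡F∘U = (λ P → J₀-fibre (F.F₁ (ρ-arr P)))
           , λ {P} {P'} h → 𝓑.Equiv.trans (𝓑.tr-resp _ _ (J₁-over (F→₁ (ρ₁ h))))
                              (𝓑.≡⇒≈ (tr-tr-sym 𝓑 (J₀-fibre (F.F₁ (ρ-arr P)))
                                                    (J₀-fibre (F.F₁ (ρ-arr P'))) _))
    where
      ρ-arr : ∀ P → U.F₀ P 𝓑.⇒ Q.F₀ P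
      ρ-arr P = ArrObj.arr (ρ₀ P)

  module _ (E-full : Full 𝓑 𝓔 E) (E-faithful : Faithful 𝓑 𝓔 E) where

    ρE-Iso : ∀ X → Iso 𝓑 (ArrObj.arr (ρ₀ (E.F₀ X)))
    ρE-Iso X = Iso-tr 𝓑 refl _ (F-resp-Iso U (unit-Iso adj E-full E-faithful X))

    lift-FρE : ∀ X → J₀ (F→₀ (ρ₀ (E.F₀ X))) 𝓔.⇒ E.F₀ (F.F₀ (Q.F₀ (E.F₀ X)))
    lift-FρE X = lift-J (F.F₁ (ArrObj.arr (ρ₀ (E.F₀ X))))

    lift-FρE-Iso : ∀ X → Iso 𝓔 (lift-FρE X)
    lift-FρE-Iso X = Cartesian-Iso U (fib.lift-cart _ _)
      (Iso-resp-≈ 𝓑 (𝓑.Equiv.sym (U-lift-J (F.F₁ (ArrObj.arr (ρ₀ (E.F₀ X))))))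
        (Iso-tr 𝓑 _ _ (F-resp-Iso F (ρE-Iso X))))

    κ : ∀ X → J₀ (F→₀ (ρ₀ (E.F₀ X))) 𝓔.⇒ E.F₀ (F.F₀ X)
    κ X = EF.F₁ (adj.counit.η X) 𝓔.∘ lift-FρE X

    κ-Iso : ∀ X → Iso 𝓔 (κ X)
    κ-Iso X = Iso-∘ 𝓔 (F-resp-Iso (E ∘F F) (counit-Iso adj E-full E-faithful X))
                      (lift-FρE-Iso X)

    κ-natural : ∀ {X X'} (f : X 𝓑.⇒ X') →
                EF.F₁ f 𝓔.∘ κ X 𝓔.≈ κ X' 𝓔.∘ J₁ (F→₁ (ρ₁ (E.F₁ f)))
    κ-natural {X} {X'} f = 𝓔.Equiv.sym (begin
      (EF.F₁ ε' 𝓔.∘ lift-FρE X') 𝓔.∘ J₁ s       ≈⟨ 𝓔.assoc ⟩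
      EF.F₁ ε' 𝓔.∘ (lift-FρE X' 𝓔.∘ J₁ s)       ≈⟨ 𝓔.∘-resp-≈ 𝓔.Equiv.refl (J₁-lift s) ⟩
      EF.F₁ ε' 𝓔.∘ (EF.F₁ QEf 𝓔.∘ lift-FρE X)   ≈⟨ 𝓔.Equiv.sym 𝓔.assoc ⟩
      (EF.F₁ ε' 𝓔.∘ EF.F₁ QEf) 𝓔.∘ lift-FρE X   ≈⟨ 𝓔.∘-resp-≈ (𝓔.Equiv.sym EF.homomorphism) 𝓔.Equiv.refl ⟩
      EF.F₁ (ε' 𝓑.∘ QEf) 𝓔.∘ lift-FρE X         ≈⟨ 𝓔.∘-resp-≈ (EF.F-resp-≈ (𝓑.Equiv.sym (adj.counit.commute f))) 𝓔.Equiv.refl ⟩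
      EF.F₁ (f 𝓑.∘ ε) 𝓔.∘ lift-FρE X            ≈⟨ 𝓔.∘-resp-≈ EF.homomorphism 𝓔.Equiv.refl ⟩
      (EF.F₁ f 𝓔.∘ EF.F₁ ε) 𝓔.∘ lift-FρE X      ≈⟨ 𝓔.assoc ⟩
      EF.F₁ f 𝓔.∘ κ X                           ∎)
      where
        open SetoidR (𝓔.hom-setoid _ _)
        s   = F→₁ (ρ₁ (E.F₁ f))
        QEf = Q.F₁ (E.F₁ f)
        ε   = adj.counit.η X
        ε'  = adj.counit.η X'

    F̌∘E≅E∘F : RawNatIso 𝓑 𝓔 (F̌ ∘R Functor.raw E) (Functor.raw (E ∘F F))
    F̌∘E≅E∘F = record
      { η       = κ
      ; η⁻¹     = λ X → Iso.inv (κ-Iso X)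
      ; isoˡ    = λ X → Iso.inverseˡ (κ-Iso X)
      ; isoʳ    = λ X → Iso.inverseʳ (κ-Iso X)
      ; commute = κ-natural
      }

lemma3p8 : ∀ {o ℓ e o' ℓ' e'} {𝓔 : Category o ℓ e} {𝓑 : Category o' ℓ' e'}
           (U : Functor 𝓔 𝓑) (fib : Fibration U)
           (E : Functor 𝓑 𝓔) (E-full : Full 𝓑 𝓔 E) (E-faithful : Faithful 𝓑 𝓔 E)
           (UE : _≡F_ 𝓑 𝓑 (U ∘F E) idF)
           (Q : Functor 𝓔 𝓑) (adj : Adjunction Q E)
           (F : Functor 𝓑 𝓑) →
           _≡R_ 𝓔 𝓑 (Functor.raw U ∘R QCE.F̌ U fib E UE Q adj F) (Functor.raw (F ∘F U))
           × RawNatIso 𝓑 𝓔 (QCE.F̌ U fib E UE Q adj F ∘R Functor.raw E) (Functor.raw (E ∘F F))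
lemma3p8 U fib E E-full E-faithful UE Q adj F =
  U∘F̌≡F∘U , F̌∘E≅E∘F E-full E-faithful
  where open F̌-Properties U fib E UE Q adj F
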